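{- Let $t\ge 0$ and let $\mathcal{T}=\{T\subseteq[n]: |T|\le t\}$. There does not exist a collusion pattern $\mathcal{T}'\subsetneq\mathcal{T}$ such that $Q^{\mathcal{T}'}=Q^\mathcal{T}$ for all linear codes $Q$ of length $n$.
   Context: A collusion pattern on $[n]$ is an abstract simplicial complex on $[n]$. The lift is $Q^\mathcal{T}=\{x\in\mathbb{F}^n : \exists y\in Q \text{ with } x|_T=y|_T \text{ for all } T\in\mathcal{T}\}$. -}

module Defs where

open import Level using (Level; _⊔_; suc)
open import Algebra.Bundles using (CommutativeRing)
open import Data.Nat using (ℕ; _≤_)
open import Data.Fin using (Fin)
open import Data.Fin.Subset using (Subset; ⊥; _⊆_; _∈_; ∣_∣)
open import Data.Product using (Σ; ∃; _×_)
open import Relation.Nullary using (¬_)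

record Field (c ℓ : Level) : Set (suc (c ⊔ ℓ)) where
  field
    commutativeRing : CommutativeRing c ℓ
  open CommutativeRing commutativeRing public
  field
    0≉1     : ¬ (0# ≈ 1#)
    inverse : ∀ x → ¬ (x ≈ 0#) → ∃ λ y → (x * y) ≈ 1#

module _ {c ℓ : Level} (F : Field c ℓ) where
  open Field F

  Word : ℕ → Set c
  Word n = Fin n → Carrier

  record LinearCode (n : ℕ) : Set (suc (c ⊔ ℓ)) where
    field
      _∈Q     : Word n → Set (c ⊔ ℓ)
      respects : ∀ {x y} → (∀ i → x i ≈ y i) → x ∈Q → y ∈Q
      zero∈   : (λ _ → 0#) ∈Q
      +-closed : ∀ {x y} → x ∈Q → y ∈Q → (λ i → x i + y i) ∈Q
      *-closed : ∀ a {x} → x ∈Q → (λ i → a * x i) ∈Q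

  AgreeOn : ∀ {n} → Subset n → Word n → Word n → Set ℓ
  AgreeOn T x y = ∀ i → i ∈ T → x i ≈ y i

  _∈Lift_of_ : ∀ {n} → Word n → (Subset n → Set) → LinearCode n → Set (c ⊔ ℓ)
  x ∈Lift 𝒯 of Q = ∀ T → 𝒯 T → ∃ λ y → (y ∈Q) × AgreeOn T x y
    where open LinearCode Q

-- A collusion pattern on [n]: an abstract simplicial complex on [n],
-- i.e. a nonempty, downward-closed family of subsets of [n].
record CollusionPattern (n : ℕ) : Set₁ where
  field
    member       : Subset n → Set
    ∅-member     : member ⊥
    down-closed  : ∀ {S S'} → S' ⊆ S → member S → member S'

Threshold : (n t : ℕ) → Subset n → Set
Threshold n t T = ∣ T ∣ ≤ t

{-# OPTIONS --safe #-}
-- Let S be a set of size at most t outside 𝒯′, pick j ∈ S (S ≠ ∅ as ∅ ∈ 𝒯′), and let Q be the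
-- code of words whose coordinates on S sum to zero. No member T of 𝒯′
-- contains S, so the unit vector e_j can be corrected into Q at a coordinate
-- of S ∖ T without changing it on T: e_j lies in Q^{𝒯′}. But e_j restricted
-- to S has sum 1, so it agrees on S ∈ 𝒯 with no codeword: e_j ∉ Q^{𝒯}.
module Submission where

open import Defs
open import Level using (Level; lift)
open import Algebra.Bundles using (Semiring)
import Algebra.Properties.CommutativeSemigroup as CommutativeSemigroupProperties
open import Data.Nat using (ℕ)
open import Data.Fin using (Fin; zero; suc)
open import Data.Fin.Properties using (any?)
open import Data.Fin.Subset using (Subset; _∈_; _∉_; _⊆_; _⊈_; inside; outside) renaming (⊥ to ∅)
open import Data.Fin.Subset.Properties using (_∈?_)
open import Data.Vec using ([]; _∷_; here; there)
open import Data.Product using (Σ; ∃; _×_; _,_; proj₁; proj₂)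
open import Relation.Nullary using (¬_; ¬?; _×-dec_; yes; no; contradiction)
open import Relation.Nullary.Decidable using (decidable-stable)
open import Relation.Binary.PropositionalEquality as ≡ using (_≡_; _≢_)
open import Function.Bundles using (_⇔_; Equivalence)
import Relation.Binary.Reasoning.Setoid as SetoidReasoning

⊈⇒∃∈∉ : ∀ {n} {S T : Subset n} → S ⊈ T → ∃ λ j → j ∈ S × j ∉ T
⊈⇒∃∈∉ {S = S} {T} S⊈T with any? (λ j → j ∈? S ×-dec ¬? (j ∈? T))
... | yes witness = witness
... | no  none    = contradiction (λ {j} → S⊆T {j}) S⊈T
  where
  S⊆T : S ⊆ T
  S⊆T {j} j∈S = decidable-stable (j ∈? T) λ j∉T → none (j , j∈S , j∉T)

module SubsetSum {c ℓ} (R : Semiring c ℓ) where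
  open Semiring R hiding (zero)
  open CommutativeSemigroupProperties +-commutativeSemigroup using (interchange)

  ∑[_] : ∀ {n} → Subset n → (Fin n → Carrier) → Carrier
  ∑[ [] ]          x = 0#
  ∑[ inside  ∷ S ] x = x zero + ∑[ S ] (λ i → x (suc i))
  ∑[ outside ∷ S ] x = ∑[ S ] (λ i → x (suc i))

  unit : ∀ {n} → Fin n → Fin n → Carrier
  unit zero    zero    = 1#
  unit zero    (suc i) = 0#
  unit (suc j) zero    = 0#
  unit (suc j) (suc i) = unit j i

  unit-≢ : ∀ {n} {j i : Fin n} → j ≢ i → unit j i ≡ 0#
  unit-≢ {j = zero}  {zero}  j≢i = contradiction ≡.refl j≢i
  unit-≢ {j = zero}  {suc i} j≢i = ≡.refl
  unit-≢ {j = suc j} {zero}  j≢i = ≡.refl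
  unit-≢ {j = suc j} {suc i} j≢i = unit-≢ (λ j≡i → j≢i (≡.cong suc j≡i))

  ∑-cong-on : ∀ {n} (S : Subset n) {x y : Fin n → Carrier} →
              (∀ i → i ∈ S → x i ≈ y i) → ∑[ S ] x ≈ ∑[ S ] y
  ∑-cong-on []            x≈y = refl
  ∑-cong-on (inside  ∷ S) x≈y = +-cong (x≈y zero here) (∑-cong-on S λ i i∈S → x≈y (suc i) (there i∈S))
  ∑-cong-on (outside ∷ S) x≈y = ∑-cong-on S λ i i∈S → x≈y (suc i) (there i∈S)

  ∑-zero : ∀ {n} (S : Subset n) → ∑[ S ] (λ _ → 0#) ≈ 0#
  ∑-zero []            = refl
  ∑-zero (inside  ∷ S) = trans (+-congˡ (∑-zero S)) (+-identityʳ 0#)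
  ∑-zero (outside ∷ S) = ∑-zero S

  ∑-distrib-+ : ∀ {n} (S : Subset n) x y → ∑[ S ] (λ i → x i + y i) ≈ ∑[ S ] x + ∑[ S ] y
  ∑-distrib-+ []            x y = sym (+-identityʳ 0#)
  ∑-distrib-+ (inside  ∷ S) x y = trans (+-congˡ (∑-distrib-+ S _ _)) (interchange _ _ _ _)
  ∑-distrib-+ (outside ∷ S) x y = ∑-distrib-+ S _ _

  ∑-scaleˡ : ∀ {n} (S : Subset n) a x → ∑[ S ] (λ i → a * x i) ≈ a * ∑[ S ] x
  ∑-scaleˡ []            a x = sym (zeroʳ a)
  ∑-scaleˡ (inside  ∷ S) a x = trans (+-congˡ (∑-scaleˡ S a _)) (sym (distribˡ a _ _))
  ∑-scaleˡ (outside ∷ S) a x = ∑-scaleˡ S a _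

  ∑-unit : ∀ {n} (S : Subset n) {j} → j ∈ S → ∑[ S ] (unit j) ≈ 1#
  ∑-unit (inside  ∷ S) here        = trans (+-congˡ (∑-zero S)) (+-identityʳ 1#)
  ∑-unit (inside  ∷ S) (there j∈S) = trans (+-identityˡ _) (∑-unit S j∈S)
  ∑-unit (outside ∷ S) (there j∈S) = ∑-unit S j∈S

module _ {c ℓ : Level} (F : Field c ℓ) where
  open Field F hiding (zero)
  open SubsetSum semiring
  open SetoidReasoning setoid

  zeroSumCode : ∀ {n} → Subset n → LinearCode F n
  zeroSumCode S = record
    { _∈Q      = λ y → Level.Lift c (∑[ S ] y ≈ 0#)
    ; respects = λ x≈y (lift ∑x≈0) → lift (trans (sym (∑-cong-on S λ i _ → x≈y i)) ∑x≈0)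
    ; zero∈    = lift (∑-zero S)
    ; +-closed = λ (lift ∑x≈0) (lift ∑y≈0) →
                   lift (trans (∑-distrib-+ S _ _) (trans (+-cong ∑x≈0 ∑y≈0) (+-identityʳ 0#)))
    ; *-closed = λ a (lift ∑x≈0) → lift (trans (∑-scaleˡ S a _) (trans (*-congˡ ∑x≈0) (zeroʳ a)))
    }

  agreeOn-zeroSumCode : ∀ {n} {S T : Subset n} {j} → j ∈ S → j ∉ T → (x : Word F n) →
                        ∃ λ y → LinearCode._∈Q (zeroSumCode S) y × AgreeOn F T x y
  agreeOn-zeroSumCode {S = S} {T} {j} j∈S j∉T x = y , lift ∑y≈0 , x≈y
    where
    s : Carrier
    s = ∑[ S ] x

    y : Word F _
    y i = x i + (- s) * unit j i

    ∑y≈0 : ∑[ S ] y ≈ 0#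
    ∑y≈0 = begin
      ∑[ S ] y                            ≈⟨ ∑-distrib-+ S x _ ⟩
      s + ∑[ S ] (λ i → (- s) * unit j i) ≈⟨ +-congˡ (∑-scaleˡ S (- s) (unit j)) ⟩
      s + (- s) * ∑[ S ] (unit j)         ≈⟨ +-congˡ (*-congˡ (∑-unit S j∈S)) ⟩
      s + (- s) * 1#                      ≈⟨ +-congˡ (*-identityʳ (- s)) ⟩
      s + (- s)                           ≈⟨ -‿inverseʳ s ⟩
      0#                                  ∎

    x≈y : AgreeOn F T x y
    x≈y i i∈T = sym (begin
      x i + (- s) * unit j i ≡⟨ ≡.cong (λ u → x i + (- s) * u) (unit-≢ j≢i) ⟩
      x i + (- s) * 0#       ≈⟨ +-congˡ (zeroʳ (- s)) ⟩
      x i + 0#               ≈⟨ +-identityʳ (x i) ⟩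
      x i                    ∎)
      where
      j≢i : j ≢ i
      j≢i ≡.refl = j∉T i∈T

  ∈Lift-zeroSumCode : ∀ {n} {S : Subset n} (𝒯 : Subset n → Set) →
                      (∀ T → 𝒯 T → S ⊈ T) → (x : Word F n) → _∈Lift_of_ F x 𝒯 (zeroSumCode S)
  ∈Lift-zeroSumCode 𝒯 S⊈ x T T∈𝒯 with ⊈⇒∃∈∉ (S⊈ T T∈𝒯)
  ... | j , j∈S , j∉T = agreeOn-zeroSumCode j∈S j∉T x

  ∈Lift-zeroSumCode⇒∑≈0 : ∀ {n} (S : Subset n) {𝒯 : Subset n → Set} → 𝒯 S →
                          {x : Word F n} → _∈Lift_of_ F x 𝒯 (zeroSumCode S) → ∑[ S ] x ≈ 0#
  ∈Lift-zeroSumCode⇒∑≈0 S S∈𝒯 x∈Lift with x∈Lift S S∈𝒯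
  ... | y , lift ∑y≈0 , x≈y = trans (∑-cong-on S x≈y) ∑y≈0

corollary3 : ∀ {c ℓ : Level} (F : Field c ℓ) (n t : ℕ) →
    ¬ (Σ (CollusionPattern n) λ T′ →
        -- T′ ⊆ T
        (∀ S → CollusionPattern.member T′ S → Threshold n t S) ×
        -- T′ ≠ T
        (∃ λ (S : Subset n) → Threshold n t S × ¬ CollusionPattern.member T′ S) ×
        -- Q^{T′} = Q^{T} for every linear code Q of length n
        (∀ (Q : LinearCode F n) (x : Word F n) →
           (_∈Lift_of_ F x (CollusionPattern.member T′) Q) ⇔ (_∈Lift_of_ F x (Threshold n t) Q)))
corollary3 F n t (T′ , _ , (S , S∈𝒯 , S∉T′) , lifts-equal) = 0≉1 (begin
  0#                ≈⟨ sym (∈Lift-zeroSumCode⇒∑≈0 F S S∈𝒯 eⱼ∈Lift𝒯) ⟩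
  ∑[ S ] (unit j)   ≈⟨ ∑-unit S j∈S ⟩
  1#                ∎)
  where
  open Field F hiding (zero)
  open SubsetSum semiring
  open SetoidReasoning setoid
  open CollusionPattern T′

  S⊈ : ∀ T → member T → S ⊈ T
  S⊈ T T∈T′ S⊆T = S∉T′ (down-closed S⊆T T∈T′)

  nonempty : ∃ λ j → j ∈ S × j ∉ ∅
  nonempty = ⊈⇒∃∈∉ (S⊈ ∅ ∅-member)

  j : Fin n
  j = proj₁ nonempty

  j∈S : j ∈ S
  j∈S = proj₁ (proj₂ nonempty)

  eⱼ∈Lift𝒯 : _∈Lift_of_ F (unit j) (Threshold n t) (zeroSumCode F S)
  eⱼ∈Lift𝒯 = Equivalence.to (lifts-equal (zeroSumCode F S) (unit j)) (∈Lift-zeroSumCode F member S⊈ (unit j))
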